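{- For every ordinal $\eta$, there is an abelian group $G$ and a generating subset $S$ of $G$ such that the generalised diameter of the Cayley graph $\mathrm{Cay}(G,S)$ is transfinite and equal to $\eta$.
   Context: A graph is a pair $(V,E)$ with $E$ a set of 2-element subsets of $V$, assumed connected and with $V\neq\varnothing$; it need not be locally finite. For a group $G$ and a generating subset $S$ (possibly infinite), $\mathrm{Cay}(G,S)$ has vertex set $G$, two distinct vertices $g,h$ being adjacent iff $g^{ -1}h\in S\cup S^{ -1}$. A path is a map $\kappa:I\to V$ with $I\subseteq\mathbb{Z}$ a non-empty integer interval (i.e. $m,n\in I$, $m\le k\le n$ imply $k\in I$) and $\{\kappa(n),\kappa(n+1)\}\in E$ whenever $n,n+1\in I$; it is geodesic if $d(\kappa(m),\kappa(n))=|m-n|$ for all $m,n\in I$, where $d$ is the graph distance. Let $\mathrm{Geod}(\mathcal{G})$ be the set of geodesic paths of $\mathcal{G}$ whose domain contains $0$ but not $-1$. Partially order it by $\gamma\leq\kappa$ iff $\gamma$ extends $\kappa$. The generalised diameter of $\mathcal{G}$ is the smallest ordinal $\eta$ for which there exists an assignment $\gamma\mapsto\xi(\gamma)$ of ordinals to elements of $\mathrm{Geod}(\mathcal{G})$ such that $\xi(\gamma)\leq\eta$ for all $\gamma$ and $\gamma<\kappa$ implies $\xi(\gamma)<\xi(\kappa)$; when such an ordinal exists the generalised diameter is called transfinite. If no such ordinal exists, the generalised diameter is defined to be $\infty$. -}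

module Defs where

open import Level using (Level; _⊔_) renaming (suc to lsuc)
open import Data.Nat using (ℕ; zero; suc; _≤_; _∸_)
open import Data.Maybe using (Maybe; just; nothing)
open import Data.Product using (Σ; _×_; _,_; proj₁)
open import Data.Sum using (_⊎_)
open import Data.Unit using (⊤)
open import Relation.Nullary using (¬_)
open import Relation.Unary using (Pred; _∈_)
open import Relation.Binary using (Rel; IsStrictTotalOrder)
open import Relation.Binary.PropositionalEquality using (_≡_)
open import Induction.WellFounded using (WellFounded)
open import Algebra.Bundles using (AbelianGroup)

-- Ordinals, represented (up to order isomorphism) by well-orders.

record WellOrder (ℓ : Level) : Set (lsuc ℓ) where
  field
    Carrier     : Set ℓ
    _<_         : Rel Carrier ℓ
    isStrictTotalOrder : IsStrictTotalOrder _≡_ _<_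
    wellFounded : WellFounded _<_

record StrictOrderTy (ℓ : Level) : Set (lsuc ℓ) where
  field
    Elt : Set ℓ
    lt  : Rel Elt ℓ

module _ {ℓ} (η : WellOrder ℓ) where
  open WellOrder η

  -- The ordinals ≤ η, i.e. the well-order η + 1 (nothing = η itself).
  data LeTop : Rel (Maybe Carrier) ℓ where
    fin<fin : ∀ {x y} → x < y → LeTop (just x) (just y)
    fin<top : ∀ {x} → LeTop (just x) nothing

  OrdinalsUpTo : StrictOrderTy ℓ
  OrdinalsUpTo = record { Elt = Maybe Carrier ; lt = LeTop }

  -- The ordinals ≤ α, where α < η is the ordinal (initial segment) given by a : η.
  OrdinalsUpToBelow : Carrier → StrictOrderTy ℓ
  OrdinalsUpToBelow a = record
    { Elt = Σ Carrier (λ x → x < a ⊎ x ≡ a)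
    ; lt  = λ p q → proj₁ p < proj₁ q }

module _ {ℓ} (G : AbelianGroup ℓ ℓ) (S : Pred (AbelianGroup.Carrier G) ℓ) where
  open AbelianGroup G

  RespectsEq : Set ℓ
  RespectsEq = ∀ {x y} → x ≈ y → x ∈ S → y ∈ S

  data Generated : Pred Carrier ℓ where
    gen-S   : ∀ {x} → x ∈ S → Generated x
    gen-ε   : Generated ε
    gen-inv : ∀ {x} → Generated x → Generated (x ⁻¹)
    gen-∙   : ∀ {x y} → Generated x → Generated y → Generated (x ∙ y)
    gen-≈   : ∀ {x y} → x ≈ y → Generated x → Generated y

  Generates : Set ℓ
  Generates = ∀ x → Generated x

  Adj : Rel Carrier ℓ
  Adj g h = ¬ (g ≈ h) × ((g ⁻¹ ∙ h) ∈ S ⊎ ((g ⁻¹ ∙ h) ⁻¹) ∈ S)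

  data Walk : Carrier → Carrier → ℕ → Set ℓ where
    nil  : ∀ {x y} → x ≈ y → Walk x y zero
    cons : ∀ {x y z k} → Adj x y → Walk y z k → Walk x z (suc k)

  -- Domains of paths containing 0 but not -1: {0,…,n} (just n) or ℕ (nothing).
  InDom : Maybe ℕ → ℕ → Set
  InDom (just n) m = m ≤ n
  InDom nothing  m = ⊤

  record GeodPath : Set ℓ where
    field
      dom   : Maybe ℕ
      path  : ℕ → Carrier
      isPath : ∀ n → InDom dom (suc n) → Adj (path n) (path (suc n))
      -- d(path m, path n) = n - m for m ≤ n in the domain: the path itself
      -- gives a walk of length n - m, and no walk is shorter.
      isGeodesic : ∀ m n → m ≤ n → InDom dom n → ∀ k →
                   Walk (path m) (path n) k → n ∸ m ≤ k

  open GeodPath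

  -- γ ≤ κ  iff  γ extends κ.
  _⊑_ : Rel GeodPath ℓ
  γ ⊑ κ = (∀ n → InDom (dom κ) n → InDom (dom γ) n)
        × (∀ n → InDom (dom κ) n → path γ n ≈ path κ n)

  _⊏_ : Rel GeodPath ℓ
  γ ⊏ κ = γ ⊑ κ × ¬ (κ ⊑ γ)

  HasRankInto : StrictOrderTy ℓ → Set ℓ
  HasRankInto T = Σ (GeodPath → StrictOrderTy.Elt T) λ ξ →
                  ∀ γ κ → γ ⊏ κ → StrictOrderTy.lt T (ξ γ) (ξ κ)

  -- The generalised diameter is transfinite and equal to η:
  -- η is a bound, and no ordinal α < η is.
  GenDiamEquals : WellOrder ℓ → Set ℓ
  GenDiamEquals η = HasRankInto (OrdinalsUpTo η)
                  × (∀ a → ¬ HasRankInto (OrdinalsUpToBelow η a))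

module Submission where

-- Let T be the tree of finite strictly decreasing sequences in η, G = ⊕_T ℤ/2 its finite subsets
-- under symmetric difference, and S the nonempty finite antichains of T. An antichain meets each
-- root-to-node chain at most once, so the number of members of F on such a chain (its height) is a
-- lower bound for the Cayley distance from 0 to F; conversely (dual Mirsky) F is the sum of its
-- levels, one antichain per height. Hence along a geodesic γ the displacement Dₙ = γ(0) + γ(n) has
-- a tall member, of height ≥ n. Rank a geodesic of length n ≥ 1 by the largest depth-n label of a
-- tall member of Dₙ, and the trivial geodesic by η. As Dₘ and Dₖ differ by γ(k) + γ(m), of height
-- ≤ m - k, a tall member of Dₘ lies above a tall member of Dₖ, whose depth-k label exceeds the
-- depth-m one; so the rank strictly decreases under extension, and no geodesic is infinite.
-- Conversely, the geodesics climbing a chain of T to a node extend one another, so a rank bounded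
-- by some α < η would yield an infinite descent in η.

open import Defs
open import Level using (Level)
open import Algebra.Bundles using (AbelianGroup)
open import Data.Bool using (Bool; true; false; not; _∧_; _xor_)
open import Data.Bool.Properties using (xor-assoc; xor-comm; xor-same; xor-identityʳ; ∧-zeroʳ)
  renaming (_≟_ to _≟ᵇ_)
open import Data.Empty using (⊥-elim)
open import Data.List using (List; []; _∷_; [_]; _++_; length; foldr; filter; map)
open import Data.List.Properties using (++-assoc; ++-identityʳ)
open import Data.List.Membership.Propositional using () renaming (_∈_ to _∈ₗ_)
open import Data.List.Membership.Propositional.Properties using (∈-map∘filter⁺; ∈-map∘filter⁻)
import Data.List.Relation.Unary.Any as Any
open import Data.List.Relation.Unary.All as All using (All; []; _∷_)
open import Data.Maybe using (Maybe; just; nothing)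
open import Data.Nat using (ℕ; zero; suc; _+_; _∸_; _≤_; _<_; _≤?_; _≟_; s≤s; z≤n)
open import Data.Nat.Properties
  using ( ≤-refl; ≤-trans; ≤-reflexive; ≤-pred; <⇒≤; <-irrefl; ≮⇒≥; ≰⇒>; ≤∧≢⇒<; m≤n⇒m<n∨m≡n
        ; m≤n⇒m≤1+n; m≤n+m; +-mono-≤; +-monoʳ-≤; +-cancelʳ-≤; +-suc; m∸n≤m; m∸n+n≡m; m+[n∸m]≡n
        ; m≤n⇒m∸n≡0; +-∸-assoc; +-commutativeSemigroup; module ≤-Reasoning )
open import Algebra.Properties.CommutativeSemigroup +-commutativeSemigroup using (interchange)
open import Data.Product using (Σ; _×_; _,_; proj₁; proj₂; ∃-syntax)
open import Data.Sum using (_⊎_; inj₁; inj₂)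
open import Data.Unit using (tt)
open import Function using (id; _∘_)
open import Induction.InfiniteDescent using (Descent; descent∧wf⇒empty)
open import Relation.Binary using (Rel; DecidableEquality; IsStrictTotalOrder; TotalOrder)
open import Relation.Binary.PropositionalEquality as ≡
  using (_≡_; refl; cong; cong₂; subst; subst₂; module ≡-Reasoning)
open import Relation.Nullary using (¬_; yes; no; does; _×-dec_)
open import Relation.Nullary.Decidable using (dec-true; dec-false; recompute)
open import Relation.Unary using (Pred; _∈_; Decidable)

module CayleyGraph {ℓ} (G : AbelianGroup ℓ ℓ) (S : Pred (AbelianGroup.Carrier G) ℓ) where
  open AbelianGroup G renaming (refl to ≈-refl)
  open import Algebra.Properties.Group group using (\\-leftDividesˡ; \\-leftDividesʳ)

  walk-≈ʳ : ∀ {x y z k} → Walk G S x y k → y ≈ z → Walk G S x z k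
  walk-≈ʳ (nil x≈y)  y≈z = nil (trans x≈y y≈z)
  walk-≈ʳ (cons a w) y≈z = cons a (walk-≈ʳ w y≈z)

  ⁻¹∙-split : ∀ g y h → g ⁻¹ ∙ h ≈ (g ⁻¹ ∙ y) ∙ (y ⁻¹ ∙ h)
  ⁻¹∙-split g y h = sym (trans (assoc (g ⁻¹) y (y ⁻¹ ∙ h)) (∙-congˡ (\\-leftDividesˡ y h)))

  InDom-≤ : ∀ d {m n} → m ≤ n → InDom G S d n → InDom G S d m
  InDom-≤ (just _) m≤n n≤N = ≤-trans m≤n n≤N
  InDom-≤ nothing  _   _   = tt

  module _ (γ : GeodPath G S) where
    open GeodPath γ

    walk-along : ∀ d i → InDom G S dom (d + i) → Walk G S (path i) (path (d + i)) d
    walk-along zero    i _         = nil ≈-refl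
    walk-along (suc d) i d+i+1∈dom = cons (isPath i (InDom-≤ dom (s≤s (m≤n+m i d)) d+i+1∈dom))
      (subst (λ j → Walk G S (path (suc i)) (path j) d) (+-suc d i)
        (walk-along d (suc i) (subst (InDom G S dom) (≡.sym (+-suc d i)) d+i+1∈dom)))

    walk-between : ∀ {m n} → m ≤ n → InDom G S dom n → Walk G S (path m) (path n) (n ∸ m)
    walk-between {m} {n} m≤n n∈dom = subst (λ j → Walk G S (path m) (path j) (n ∸ m)) (m∸n+n≡m m≤n)
      (walk-along (n ∸ m) m (subst (InDom G S dom) (≡.sym (m∸n+n≡m m≤n)) n∈dom))

  module _ (‖_‖ : Carrier → ℕ)
           (‖‖-cong : ∀ {x y} → x ≈ y → ‖ x ‖ ≡ ‖ y ‖)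
           (‖ε‖≡0 : ‖ ε ‖ ≡ 0)
           (‖‖-subadditive : ∀ x y → ‖ x ∙ y ‖ ≤ ‖ x ‖ + ‖ y ‖)
           (‖‖-⁻¹ : ∀ x → ‖ x ⁻¹ ‖ ≡ ‖ x ‖)
           (‖S‖≤1 : ∀ {x} → x ∈ S → ‖ x ‖ ≤ 1)
           where

    ‖adj‖≤1 : ∀ {g h} → Adj G S g h → ‖ g ⁻¹ ∙ h ‖ ≤ 1
    ‖adj‖≤1         (_ , inj₁ x∈S)   = ‖S‖≤1 x∈S
    ‖adj‖≤1 {g} {h} (_ , inj₂ x⁻¹∈S) = ≤-trans (≤-reflexive (≡.sym (‖‖-⁻¹ (g ⁻¹ ∙ h)))) (‖S‖≤1 x⁻¹∈S)

    ‖‖≤walkLength : ∀ {g h k} → Walk G S g h k → ‖ g ⁻¹ ∙ h ‖ ≤ k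
    ‖‖≤walkLength {g} {h} (nil g≈h) =
      ≤-reflexive (≡.trans (‖‖-cong (trans (∙-congˡ (sym g≈h)) (inverseˡ g))) ‖ε‖≡0)
    ‖‖≤walkLength {g} {h} (cons {y = y} {k = k} g~y w) = begin
      ‖ g ⁻¹ ∙ h ‖                 ≡⟨ ‖‖-cong (⁻¹∙-split g y h) ⟩
      ‖ (g ⁻¹ ∙ y) ∙ (y ⁻¹ ∙ h) ‖  ≤⟨ ‖‖-subadditive _ _ ⟩
      ‖ g ⁻¹ ∙ y ‖ + ‖ y ⁻¹ ∙ h ‖  ≤⟨ +-mono-≤ (‖adj‖≤1 g~y) (‖‖≤walkLength w) ⟩
      suc k                        ∎
      where open ≤-Reasoning

  ∏ : List Carrier → Carrier
  ∏ = foldr _∙_ ε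

  module _ (S-respects-≈ : RespectsEq G S) (ε∉S : ∀ {x} → x ∈ S → ¬ x ≈ ε) where

    adj-∙ : ∀ {g h x} → x ∈ S → h ≈ g ∙ x → Adj G S g h
    adj-∙ {g} {h} {x} x∈S h≈g∙x = g≉h , inj₁ (S-respects-≈ x≈g⁻¹∙h x∈S)
      where
      x≈g⁻¹∙h : x ≈ g ⁻¹ ∙ h
      x≈g⁻¹∙h = trans (sym (\\-leftDividesʳ g x)) (∙-congˡ (sym h≈g∙x))
      g≉h : ¬ g ≈ h
      g≉h g≈h = ε∉S x∈S (trans x≈g⁻¹∙h (trans (∙-congˡ (sym g≈h)) (inverseˡ g)))

    walk-to-∏ : ∀ g xs → All (λ x → x ∈ S ⊎ x ≈ ε) xs →
                ∃[ k ] k ≤ length xs × Walk G S g (g ∙ ∏ xs) k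
    walk-to-∏ g []       []                = 0 , z≤n , nil (sym (identityʳ g))
    walk-to-∏ g (x ∷ xs) (inj₁ x∈S ∷ xs⊆S) with walk-to-∏ (g ∙ x) xs xs⊆S
    ... | k , k≤ , w = suc k , s≤s k≤ , cons (adj-∙ x∈S ≈-refl) (walk-≈ʳ w (assoc g x (∏ xs)))
    walk-to-∏ g (x ∷ xs) (inj₂ x≈ε ∷ xs⊆S) with walk-to-∏ g xs xs⊆S
    ... | k , k≤ , w = k , m≤n⇒m≤1+n k≤ , walk-≈ʳ w (∙-congˡ (sym (trans (∙-congʳ x≈ε) (identityˡ (∏ xs)))))

-- ⊕_A ℤ/2: a list stands for the set of elements occurring in it an odd number of times.
module ParityGroup {a} {A : Set a} (_≟_ : DecidableEquality A) where
  open ≡ using (sym; trans)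

  parity : A → List A → Bool
  parity t []      = false
  parity t (u ∷ F) = does (t ≟ u) xor parity t F

  infix 4 _≈_
  _≈_ : Rel (List A) a
  F ≈ F′ = ∀ t → parity t F ≡ parity t F′

  parity-++ : ∀ t F F′ → parity t (F ++ F′) ≡ parity t F xor parity t F′
  parity-++ t []      F′ = refl
  parity-++ t (u ∷ F) F′ =
    trans (cong (does (t ≟ u) xor_) (parity-++ t F F′)) (sym (xor-assoc (does (t ≟ u)) (parity t F) (parity t F′)))

  ++-cong : ∀ {F F′ H H′} → F ≈ F′ → H ≈ H′ → F ++ H ≈ F′ ++ H′
  ++-cong {F} {F′} {H} {H′} F≈F′ H≈H′ t = begin
    parity t (F ++ H)            ≡⟨ parity-++ t F H ⟩
    parity t F xor parity t H    ≡⟨ cong₂ _xor_ (F≈F′ t) (H≈H′ t) ⟩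
    parity t F′ xor parity t H′  ≡⟨ parity-++ t F′ H′ ⟨
    parity t (F′ ++ H′)          ∎
    where open ≡-Reasoning

  open import Algebra.Structures _≈_ using (IsAbelianGroup)

  isAbelianGroup : IsAbelianGroup _++_ [] id
  isAbelianGroup = record
    { isGroup = record
      { isMonoid = record
        { isSemigroup = record
          { isMagma = record
            { isEquivalence = record
              { refl = λ _ → refl ; sym = λ e t → sym (e t) ; trans = λ e f t → trans (e t) (f t) }
            ; ∙-cong = λ {F} {F′} {H} {H′} → ++-cong {F} {F′} {H} {H′} }
          ; assoc = λ F H K t → cong (parity t) (++-assoc F H K) }
        ; identity = (λ _ _ → refl) , (λ F t → cong (parity t) (++-identityʳ F)) }
      ; inverse = F++F≈[] , F++F≈[]
      ; ⁻¹-cong = id }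
    ; comm = λ F H t →
        trans (parity-++ t F H) (trans (xor-comm (parity t F) (parity t H)) (sym (parity-++ t H F))) }
    where
    F++F≈[] : ∀ F → F ++ F ≈ []
    F++F≈[] F t = trans (parity-++ t F F) (xor-same (parity t F))

  abelianGroup : AbelianGroup a a
  abelianGroup = record { isAbelianGroup = isAbelianGroup }

  parity-[_] : ∀ t → parity t [ t ] ≡ true
  parity-[ t ] rewrite dec-true (t ≟ t) refl = refl

  parity-[]⇒≡ : ∀ {s t} → parity s [ t ] ≡ true → s ≡ t
  parity-[]⇒≡ {s} {t} eq with s ≟ t
  ... | yes s≡t = s≡t

  parity⇒∈ : ∀ {t F} → parity t F ≡ true → t ∈ₗ F
  parity⇒∈ {t} {u ∷ F} eq with t ≟ u
  ... | yes t≡u = Any.here t≡u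
  ... | no  _   = Any.there (parity⇒∈ eq)

  parity-filter : ∀ {p} {P : Pred A p} (P? : Decidable P) t F →
                  parity t (filter P? F) ≡ does (P? t) ∧ parity t F
  parity-filter P? t []      = sym (∧-zeroʳ _)
  parity-filter P? t (u ∷ F) with t ≟ u
  ... | yes refl with does (P? t) in P[t]
  ...   | true rewrite dec-true (t ≟ t) refl =
    cong not (trans (parity-filter P? t F) (cong (_∧ parity t F) P[t]))
  ...   | false = trans (parity-filter P? t F) (cong (_∧ parity t F) P[t])
  parity-filter P? t (u ∷ F) | no t≢u with does (P? u)
  ...   | true rewrite dec-false (t ≟ u) t≢u = parity-filter P? t F
  ...   | false = parity-filter P? t F

  parity-filter⁻ : ∀ {p} {P : Pred A p} (P? : Decidable P) {t} F →
                   parity t (filter P? F) ≡ true → P t × parity t F ≡ true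
  parity-filter⁻ P? {t} F t∈PF with P? t | parity-filter P? t F
  ... | yes Pt | eq = Pt , trans (sym eq) t∈PF
  ... | no  _  | eq with () ← trans (sym eq) t∈PF

  ≈[]⊎parity≡true : ∀ F → F ≈ [] ⊎ ∃[ t ] parity t F ≡ true
  ≈[]⊎parity≡true F with Any.any? (λ t → parity t F ≟ᵇ true) F
  ... | yes ∃t = inj₂ (Any.satisfied ∃t)
  ... | no  ∄t = inj₁ parity≡false
    where
    parity≡false : ∀ t → parity t F ≡ false
    parity≡false t with parity t F in eq
    ... | false = refl
    ... | true  = ⊥-elim (∄t (Any.map (λ t≡u → subst (λ v → parity v F ≡ true) t≡u eq) (parity⇒∈ eq)))

  singletons-generate : (S : Pred (List A) a) → (∀ t → [ t ] ∈ S) → Generates abelianGroup S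
  singletons-generate S [t]∈S []      = gen-ε
  singletons-generate S [t]∈S (t ∷ F) = gen-∙ (gen-S ([t]∈S t)) (singletons-generate S [t]∈S F)

module ChainTree {ℓ} (η : WellOrder ℓ) where
  open WellOrder η renaming (Carrier to C; _<_ to _≺_)
  open IsStrictTotalOrder isStrictTotalOrder using (_<?_) renaming (_≟_ to _≟C_; trans to ≺-trans)
  open import Relation.Binary.Construct.StrictToNonStrict _≡_ _≺_ using ()
    renaming (_≤_ to _≼_; isTotalOrder to ≼-isTotalOrder)
  open import Relation.Binary.Construct.Add.Infimum.NonStrict _≼_ using (≤₋-isTotalOrder-≡)
    renaming ([_] to [_]≼)

  ≺-≼-trans : ∀ {x y z} → x ≺ y → y ≼ z → x ≺ z
  ≺-≼-trans x≺y (inj₁ y≺z) = ≺-trans x≺y y≺z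
  ≺-≼-trans x≺y (inj₂ refl) = x≺y

  -- A node is a finite strictly decreasing sequence in η, built from its first term ⟨ a ⟩ by
  -- appending terms below its last one (its label). The proof of decrease is irrelevant, so Node
  -- has decidable equality without ≺ having to be proof-irrelevant.
  data Node : Set ℓ
  label : Node → C

  data Node where
    ⟨_⟩    : C → Node
    extend : (t : Node) (x : C) → .(x ≺ label t) → Node

  label ⟨ x ⟩          = x
  label (extend _ x _) = x

  depth : Node → ℕ
  depth ⟨ _ ⟩          = 1
  depth (extend t _ _) = suc (depth t)

  _≟ₙ_ : DecidableEquality Node
  ⟨ x ⟩ ≟ₙ ⟨ y ⟩ with x ≟C y
  ... | yes refl = yes refl
  ... | no  x≢y  = no λ { refl → x≢y refl }
  extend s x _ ≟ₙ extend t y _ with s ≟ₙ t | x ≟C y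
  ... | yes refl | yes refl = yes refl
  ... | no  s≢t  | _        = no λ { refl → s≢t refl }
  ... | _        | no  x≢y  = no λ { refl → x≢y refl }
  ⟨ _ ⟩ ≟ₙ extend _ _ _ = no λ ()
  extend _ _ _ ≟ₙ ⟨ _ ⟩ = no λ ()

  data _⊂_ : Rel Node ℓ where
    parent   : ∀ {t x} .{x≺ : x ≺ label t} → t ⊂ extend t x x≺
    ancestor : ∀ {s t x} .{x≺ : x ≺ label t} → s ⊂ t → s ⊂ extend t x x≺

  ⊂-extend : ∀ {u s x} .{x≺ : x ≺ label s} → u ≡ s ⊎ u ⊂ s → u ⊂ extend s x x≺
  ⊂-extend (inj₁ refl) = parent
  ⊂-extend (inj₂ u⊂s)  = ancestor u⊂s

  ⊂⇒depth< : ∀ {s t} → s ⊂ t → depth s < depth t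
  ⊂⇒depth< parent         = ≤-refl
  ⊂⇒depth< (ancestor s⊂t) = m≤n⇒m≤1+n (⊂⇒depth< s⊂t)

  ⊂-irrefl : ∀ {t} → ¬ t ⊂ t
  ⊂-irrefl t⊂t = <-irrefl refl (⊂⇒depth< t⊂t)

  open ParityGroup _≟ₙ_

  -- Height, and the Cayley distance in ⊕_T ℤ/2

  𝟙 : Bool → ℕ
  𝟙 true  = 1
  𝟙 false = 0

  𝟙≤1 : ∀ b → 𝟙 b ≤ 1
  𝟙≤1 true  = ≤-refl
  𝟙≤1 false = z≤n

  𝟙-xor : ∀ a b → 𝟙 (a xor b) ≤ 𝟙 a + 𝟙 b
  𝟙-xor true  true  = z≤n
  𝟙-xor true  false = ≤-refl
  𝟙-xor false b     = ≤-refl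

  𝟙-parity-++ : ∀ F F′ t → 𝟙 (parity t (F ++ F′)) ≤ 𝟙 (parity t F) + 𝟙 (parity t F′)
  𝟙-parity-++ F F′ t rewrite parity-++ t F F′ = 𝟙-xor (parity t F) (parity t F′)

  height : List Node → Node → ℕ
  height F t@(⟨ _ ⟩)        = 𝟙 (parity t F)
  height F t@(extend s _ _) = 𝟙 (parity t F) + height F s

  height-cong : ∀ {F F′} → F ≈ F′ → ∀ t → height F t ≡ height F′ t
  height-cong F≈F′ t@(⟨ _ ⟩)        = cong 𝟙 (F≈F′ t)
  height-cong F≈F′ t@(extend s _ _) = cong₂ _+_ (cong 𝟙 (F≈F′ t)) (height-cong F≈F′ s)

  height-[] : ∀ t → height [] t ≡ 0
  height-[] ⟨ _ ⟩          = refl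
  height-[] (extend s _ _) = height-[] s

  height-++ : ∀ F F′ t → height (F ++ F′) t ≤ height F t + height F′ t
  height-++ F F′ t@(⟨ _ ⟩) = 𝟙-parity-++ F F′ t
  height-++ F F′ t@(extend s _ _) = begin
    𝟙 (parity t (F ++ F′)) + height (F ++ F′) s
      ≤⟨ +-mono-≤ (𝟙-parity-++ F F′ t) (height-++ F F′ s) ⟩
    (𝟙 (parity t F) + 𝟙 (parity t F′)) + (height F s + height F′ s)
      ≡⟨ interchange (𝟙 (parity t F)) (𝟙 (parity t F′)) (height F s) (height F′ s) ⟩
    (𝟙 (parity t F) + height F s) + (𝟙 (parity t F′) + height F′ s)
      ∎
    where open ≤-Reasoning

  height≤depth : ∀ F t → height F t ≤ depth t
  height≤depth F t@(⟨ _ ⟩)        = 𝟙≤1 (parity t F)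
  height≤depth F t@(extend s _ _) = +-mono-≤ (𝟙≤1 (parity t F)) (height≤depth F s)

  height-⊂ : ∀ F {s t} → s ⊂ t → 𝟙 (parity t F) + height F s ≤ height F t
  height-⊂ F parent         = ≤-refl
  height-⊂ F (ancestor s⊂t) = +-monoʳ-≤ _ (≤-trans (m≤n+m _ _) (height-⊂ F s⊂t))

  member⇒1≤height : ∀ {F} t → parity t F ≡ true → 1 ≤ height F t
  member⇒1≤height ⟨ _ ⟩          t∈F rewrite t∈F = ≤-refl
  member⇒1≤height (extend _ _ _) t∈F rewrite t∈F = s≤s z≤n

  lowest-member : ∀ F t → 1 ≤ height F t →
                  ∃[ s ] (s ≡ t ⊎ s ⊂ t) × parity s F ≡ true × height F s ≡ height F t
  lowest-member F t 1≤h with parity t F in t∈F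
  ... | true = t , inj₁ refl , t∈F , refl
  lowest-member F ⟨ _ ⟩ 1≤h | false with () ← subst (λ b → 1 ≤ 𝟙 b) t∈F 1≤h
  lowest-member F t@(extend s _ _) 1≤h | false
    with lowest-member F s (subst (λ b → 1 ≤ 𝟙 b + height F s) t∈F 1≤h)
  ... | u , u⊆s , u∈F , h≡ = u , inj₂ (⊂-extend u⊆s) , u∈F , ≡.trans h≡ (cong (λ b → 𝟙 b + height F s) (≡.sym t∈F))

  IsAntichain : Pred (List Node) ℓ
  IsAntichain F = ∀ {s t} → parity s F ≡ true → parity t F ≡ true → ¬ s ⊂ t

  height-antichain : ∀ {A} → IsAntichain A → ∀ t → height A t ≤ 1
  height-antichain {A} A-anti t@(⟨ _ ⟩) = 𝟙≤1 (parity t A)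
  height-antichain {A} A-anti t@(extend s _ _) with parity t A in t∈A
  ... | false = height-antichain A-anti s
  ... | true with height A s in h
  ...   | zero  = ≤-refl
  ...   | suc _ with lowest-member A s (subst (1 ≤_) (≡.sym h) (s≤s z≤n))
  ...     | u , u⊆s , u∈A , _ = ⊥-elim (A-anti u∈A t∈A (⊂-extend u⊆s))

  Generator : Pred (List Node) ℓ
  Generator F = ¬ F ≈ [] × IsAntichain F

  Generator-respects-≈ : RespectsEq abelianGroup Generator
  Generator-respects-≈ F≈F′ (F≉[] , F-anti) =
    (λ F′≈[] → F≉[] (λ t → ≡.trans (F≈F′ t) (F′≈[] t))) ,
    (λ s∈F′ t∈F′ → F-anti (≡.trans (F≈F′ _) s∈F′) (≡.trans (F≈F′ _) t∈F′))

  member⇒≉[] : ∀ F {t} → parity t F ≡ true → ¬ F ≈ []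
  member⇒≉[] F {t} t∈F F≈[] with () ← ≡.trans (≡.sym t∈F) (F≈[] t)

  [_]-generator : ∀ t → Generator [ t ]
  [ t ]-generator = member⇒≉[] [ t ] {t} parity-[ t ] ,
    λ s∈[t] u∈[t] s⊂u → ⊂-irrefl (subst₂ _⊂_ (parity-[]⇒≡ s∈[t]) (parity-[]⇒≡ u∈[t]) s⊂u)

  open CayleyGraph abelianGroup Generator
  open import Algebra.Properties.Group (AbelianGroup.group abelianGroup) using (\\-leftDividesˡ)

  height≤walkLength : ∀ t {g h k} → Walk abelianGroup Generator g h k → height (g ++ h) t ≤ k
  height≤walkLength t = ‖‖≤walkLength (λ F → height F t) (λ F≈F′ → height-cong F≈F′ t) (height-[] t)
    (λ F F′ → height-++ F F′ t) (λ _ → refl) (λ F∈S → height-antichain (proj₂ F∈S) t)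

  layer : List Node → ℕ → List Node
  layer F i = filter (λ t → height F t ≟ i) F

  layers : List Node → ℕ → List (List Node)
  layers F zero    = []
  layers F (suc j) = layer F (suc j) ∷ layers F j

  layer-antichain : ∀ F i → IsAntichain (layer F i)
  layer-antichain F i {s} {t} s∈L t∈L s⊂t with parity-filter⁻ (λ u → height F u ≟ i) F s∈L
                                               | parity-filter⁻ (λ u → height F u ≟ i) F t∈L
  ... | refl , _ | ht , t∈F =
    <-irrefl (≡.sym ht) (subst (λ b → 𝟙 b + height F s ≤ height F t) t∈F (height-⊂ F s⊂t))

  layer-generator-or-empty : ∀ F i → Generator (layer F i) ⊎ layer F i ≈ []
  layer-generator-or-empty F i with ≈[]⊎parity≡true (layer F i)
  ... | inj₁ L≈[]       = inj₂ L≈[]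
  ... | inj₂ (t , t∈L)  = inj₁ (member⇒≉[] (layer F i) t∈L , layer-antichain F i)

  parity-layers-∉ : ∀ F t j → parity t F ≡ false → parity t (∏ (layers F j)) ≡ false
  parity-layers-∉ F t zero    _   = refl
  parity-layers-∉ F t (suc j) t∉F
    rewrite parity-++ t (layer F (suc j)) (∏ (layers F j)) | parity-filter (λ u → height F u ≟ suc j) t F
          | t∉F | ∧-zeroʳ (does (height F t ≟ suc j)) = parity-layers-∉ F t j t∉F

  parity-layers-above : ∀ F t j → j < height F t → parity t (∏ (layers F j)) ≡ false
  parity-layers-above F t zero    _   = refl
  parity-layers-above F t (suc j) j<h
    rewrite parity-++ t (layer F (suc j)) (∏ (layers F j)) | parity-filter (λ u → height F u ≟ suc j) t F
          | dec-false (height F t ≟ suc j) (λ h≡ → <-irrefl (≡.sym h≡) j<h) =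
    parity-layers-above F t j (<⇒≤ j<h)

  parity-layers : ∀ F t j → height F t ≤ j → parity t (∏ (layers F j)) ≡ parity t F
  parity-layers F t zero h≤0 with parity t F in t∈F
  ... | false = refl
  ... | true with () ← ≤-trans (member⇒1≤height t t∈F) h≤0
  parity-layers F t (suc j) h≤j+1
    rewrite parity-++ t (layer F (suc j)) (∏ (layers F j)) | parity-filter (λ u → height F u ≟ suc j) t F
    with height F t ≟ suc j
  ... | yes h≡ rewrite dec-true (height F t ≟ suc j) h≡ | parity-layers-above F t j (≤-reflexive (≡.sym h≡)) =
    xor-identityʳ (parity t F)
  ... | no  h≢ rewrite dec-false (height F t ≟ suc j) h≢ = parity-layers F t j (≤-pred (≤∧≢⇒< h≤j+1 h≢))

  length-layers : ∀ F j → length (layers F j) ≡ j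
  length-layers F zero    = refl
  length-layers F (suc j) = cong suc (length-layers F j)

  layers-generators-or-empty : ∀ F j → All (λ L → Generator L ⊎ L ≈ []) (layers F j)
  layers-generators-or-empty F zero    = []
  layers-generators-or-empty F (suc j) = layer-generator-or-empty F (suc j) ∷ layers-generators-or-empty F j

  ≈∏layers : ∀ F j → (∀ {t} → parity t F ≡ true → height F t ≤ j) → F ≈ ∏ (layers F j)
  ≈∏layers F j F-low t with parity t F in t∈F
  ... | true  = ≡.sym (≡.trans (parity-layers F t j (F-low t∈F)) t∈F)
  ... | false = ≡.sym (parity-layers-∉ F t j t∈F)

  mirsky-walk : ∀ g F j → (∀ {t} → parity t F ≡ true → height F t ≤ j) →
                ∃[ k ] k ≤ j × Walk abelianGroup Generator g (g ++ F) k
  mirsky-walk g F j F-low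
    with walk-to-∏ (λ {x} {y} → Generator-respects-≈ {x} {y}) proj₁ g (layers F j) (layers-generators-or-empty F j)
  ... | k , k≤ , w = k , subst (k ≤_) (length-layers F j) k≤ ,
    walk-≈ʳ w (++-cong {g} {g} {∏ (layers F j)} {F} (λ _ → refl) (λ t → ≡.sym (≈∏layers F j F-low t)))

  -- The rank of a geodesic

  -- The label of the ancestor of t at depth k, for 1 ≤ k ≤ depth t.
  labelAt : ℕ → Node → C
  labelAt _ ⟨ x ⟩          = x
  labelAt k (extend t x _) with k ≤? depth t
  ... | yes _ = labelAt k t
  ... | no  _ = x

  labelAt-extend : ∀ {k t x} .{x≺ : x ≺ label t} → k ≤ depth t → labelAt k (extend t x x≺) ≡ labelAt k t
  labelAt-extend {k} {t} k≤ with k ≤? depth t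
  ... | yes _ = refl
  ... | no  k≰ = ⊥-elim (k≰ k≤)

  label≼labelAt : ∀ k t → label t ≼ labelAt k t
  label≼labelAt k ⟨ x ⟩ = inj₂ refl
  label≼labelAt k (extend t x x≺) with k ≤? depth t
  ... | yes _ = inj₁ (≺-≼-trans (recompute (x <? label t) x≺) (label≼labelAt k t))
  ... | no  _ = inj₂ refl

  labelAt-⊂ : ∀ {k s t} → s ⊂ t → k ≤ depth s → labelAt k s ≡ labelAt k t
  labelAt-⊂ parent k≤ = ≡.sym (labelAt-extend k≤)
  labelAt-⊂ (ancestor s⊂t) k≤ =
    ≡.trans (labelAt-⊂ s⊂t k≤) (≡.sym (labelAt-extend (≤-trans k≤ (<⇒≤ (⊂⇒depth< s⊂t)))))

  labelAt-⊆ : ∀ {k s t} → s ≡ t ⊎ s ⊂ t → k ≤ depth s → labelAt k s ≡ labelAt k t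
  labelAt-⊆ (inj₁ refl) _   = refl
  labelAt-⊆ (inj₂ s⊂t)  k≤ = labelAt-⊂ s⊂t k≤

  labelAt-decreasing : ∀ {k m} t → 1 ≤ k → k < m → m ≤ depth t → labelAt m t ≺ labelAt k t
  labelAt-decreasing ⟨ _ ⟩ (s≤s z≤n) (s≤s ()) (s≤s z≤n)
  labelAt-decreasing {k} {m} (extend t x x≺) 1≤k k<m m≤ with m ≤? depth t
  ... | yes m≤ rewrite labelAt-extend {x = x} {x≺ = x≺} (≤-trans (<⇒≤ k<m) m≤) = labelAt-decreasing t 1≤k k<m m≤
  ... | no  m≰ rewrite labelAt-extend {x = x} {x≺ = x≺} (≤-pred (≤-trans k<m m≤)) =
    ≺-≼-trans (recompute (x <? label t) x≺) (label≼labelAt k t)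

  Geodesic : Set ℓ
  Geodesic = GeodPath abelianGroup Generator

  open GeodPath

  InDomain : Geodesic → ℕ → Set
  InDomain γ = InDom abelianGroup Generator (dom γ)

  last∈domain : ∀ γ {n} → dom γ ≡ just n → InDomain γ n
  last∈domain γ dom≡n = subst (λ d → InDom abelianGroup Generator d _) (≡.sym dom≡n) ≤-refl

  displacement : Geodesic → ℕ → List Node
  displacement γ n = path γ 0 ++ path γ n

  height-along : ∀ (γ : Geodesic) t {m n} → m ≤ n → InDomain γ n → height (path γ m ++ path γ n) t ≤ n ∸ m
  height-along γ t m≤n n∈γ = height≤walkLength t (walk-between γ m≤n n∈γ)

  Tall : ℕ → List Node → Node → Set
  Tall n F t = parity t F ≡ true × n ≤ height F t

  tall? : ∀ n F → Decidable (Tall n F)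
  tall? n F t = (parity t F ≟ᵇ true) ×-dec (n ≤? height F t)

  Tall-cong : ∀ {n F F′ t} → F ≈ F′ → Tall n F t → Tall n F′ t
  Tall-cong {n} {t = t} F≈F′ (t∈F , n≤h) = ≡.trans (≡.sym (F≈F′ t)) t∈F , subst (n ≤_) (height-cong F≈F′ t) n≤h

  tall-member : ∀ γ {n} → InDomain γ (suc n) → ∃[ t ] Tall (suc n) (displacement γ (suc n)) t
  tall-member γ {n} n+1∈γ with Any.any? (tall? (suc n) D) D
    where D = displacement γ (suc n)
  ... | yes ∃t = Any.satisfied ∃t
  ... | no  ∄t with mirsky-walk (path γ 0) D n D-low
    where
    D = displacement γ (suc n)
    D-low : ∀ {t} → parity t D ≡ true → height D t ≤ n
    D-low {t} t∈D = ≮⇒≥ λ n<h → ∄t (Any.map (λ t≡u → subst (Tall (suc n) D) t≡u (t∈D , n<h)) (parity⇒∈ t∈D))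
  ...   | k , k≤n , w = ⊥-elim (<-irrefl refl (≤-trans (isGeodesic γ 0 (suc n) z≤n n+1∈γ k w′) k≤n))
    where
    w′ : Walk abelianGroup Generator (path γ 0) (path γ (suc n)) k
    w′ = walk-≈ʳ w (\\-leftDividesˡ (path γ 0) (path γ (suc n)))

  rankOrder : TotalOrder ℓ ℓ ℓ
  rankOrder = record { isTotalOrder = ≤₋-isTotalOrder-≡ (≼-isTotalOrder isStrictTotalOrder) }

  open import Data.List.Extrema rankOrder using (max; xs≤max; argmax-sel)

  -- Here nothing is the least element (no tall member); in rankOf it stands for η instead.
  rankAt : ℕ → List Node → Maybe C
  rankAt n F = max nothing (map (just ∘ labelAt n) (filter (tall? n F) F))

  rankAt-upper : ∀ n F {t} → Tall n F t → ∃[ c ] rankAt n F ≡ just c × labelAt n t ≼ c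
  rankAt-upper n F {t} t-tall with rankAt n F | All.lookup (xs≤max nothing _) t∈candidates
    where
    t∈candidates : just (labelAt n t) ∈ₗ map (just ∘ labelAt n) (filter (tall? n F) F)
    t∈candidates =
      ∈-map∘filter⁺ (just ∘ labelAt n) (tall? n F) {xs = F} (t , parity⇒∈ (proj₁ t-tall) , refl , t-tall)
  ... | just c | [ t≼c ]≼ = c , refl , t≼c

  rankAt-attained : ∀ n F {t} → Tall n F t → ∃[ t′ ] Tall n F t′ × rankAt n F ≡ just (labelAt n t′)
  rankAt-attained n F t-tall with argmax-sel id nothing (map (just ∘ labelAt n) (filter (tall? n F) F))
  ... | inj₂ r∈ with ∈-map∘filter⁻ (just ∘ labelAt n) (tall? n F) {xs = F} r∈
  ...   | t′ , _ , r≡ , t′-tall = t′ , t′-tall , r≡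
  rankAt-attained n F t-tall | inj₁ r≡nothing with rankAt-upper n F t-tall
  ... | c , r≡c , _ with () ← ≡.trans (≡.sym r≡nothing) r≡c

  height-displacement-≥ : ∀ γ {k m} t → k ≤ m → InDomain γ m → m ≤ height (displacement γ m) t →
                          k ≤ height (displacement γ k) t
  height-displacement-≥ γ {k} {m} t k≤m m∈γ m≤h =
    +-cancelʳ-≤ (m ∸ k) k _ (subst (_≤ height (displacement γ k) t + (m ∸ k)) (≡.sym (m+[n∸m]≡n k≤m)) m≤h+m∸k)
    where
    open ≤-Reasoning
    m≤h+m∸k : m ≤ height (displacement γ k) t + (m ∸ k)
    m≤h+m∸k = begin
      m                                                              ≤⟨ m≤h ⟩
      height (displacement γ m) t
        ≡⟨ height-cong (⁻¹∙-split (path γ 0) (path γ k) (path γ m)) t ⟩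
      height (displacement γ k ++ (path γ k ++ path γ m)) t
        ≤⟨ height-++ (displacement γ k) _ t ⟩
      height (displacement γ k) t + height (path γ k ++ path γ m) t
        ≤⟨ +-monoʳ-≤ _ (height-along γ t k≤m m∈γ) ⟩
      height (displacement γ k) t + (m ∸ k)
        ∎

  labelAt-descends : ∀ γ {k m} → 1 ≤ k → k < m → InDomain γ m → ∀ t → m ≤ height (displacement γ m) t →
                   ∃[ v ] Tall k (displacement γ k) v × labelAt m t ≺ labelAt k v
  labelAt-descends γ {k} {m} 1≤k k<m m∈γ t m≤h
    with k≤h ← height-displacement-≥ γ t (<⇒≤ k<m) m∈γ m≤h
    with lowest-member (displacement γ k) t (≤-trans 1≤k k≤h)
  ... | v , v⊆t , v∈D , hv≡ht =
    v , (v∈D , subst (k ≤_) (≡.sym hv≡ht) k≤h) ,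
    subst (labelAt m t ≺_) (≡.sym (labelAt-⊆ v⊆t k≤depth)) (labelAt-decreasing t 1≤k k<m (≤-trans m≤h (height≤depth _ t)))
    where
    k≤depth : k ≤ depth v
    k≤depth = ≤-trans k≤h (≤-trans (≤-reflexive (≡.sym hv≡ht)) (height≤depth _ v))

  rankAt-just : ∀ γ {n} → InDomain γ (suc n) → ∃[ c ] rankAt (suc n) (displacement γ (suc n)) ≡ just c
  rankAt-just γ {n} n+1∈γ
    with c , r≡c , _ ← rankAt-upper (suc n) (displacement γ (suc n)) (proj₂ (tall-member γ n+1∈γ)) = c , r≡c

  LeTop-just : ∀ {x y a b} → x ≡ just a → y ≡ just b → a ≺ b → LeTop η x y
  LeTop-just refl refl = fin<fin

  LeTop-just⁻¹ : ∀ {x y a b} → x ≡ just a → y ≡ just b → LeTop η x y → a ≺ b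
  LeTop-just⁻¹ refl refl (fin<fin a≺b) = a≺b

  rankAt-decreasing : ∀ γ κ {k m} → 1 ≤ k → k < m → InDomain γ m → displacement γ k ≈ displacement κ k →
                      LeTop η (rankAt m (displacement γ m)) (rankAt k (displacement κ k))
  rankAt-decreasing γ κ {k} {suc m} 1≤k k<m m∈γ Dγ≈Dκ
    with t₀ , t₀-tall ← tall-member γ m∈γ
    with t , (_ , m≤h) , r≡t ← rankAt-attained (suc m) (displacement γ (suc m)) t₀-tall
    with v , v-tall , t≺v ← labelAt-descends γ 1≤k k<m m∈γ t m≤h
    with c , r≡c , v≼c ← rankAt-upper k (displacement κ k)
                             (Tall-cong {k} {displacement γ k} {displacement κ k} {v} Dγ≈Dκ v-tall)
    = LeTop-just r≡t r≡c (≺-≼-trans t≺v v≼c)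

  finite-domain : ∀ γ → ¬ dom γ ≡ nothing
  finite-domain γ dom≡nothing = descent∧wf⇒empty descent wellFounded (r 0) (0 , refl)
    where
    ∈γ : ∀ n → InDomain γ n
    ∈γ n = subst (λ d → InDom abelianGroup Generator d n) (≡.sym dom≡nothing) tt
    r : ℕ → C
    r n = proj₁ (rankAt-just γ (∈γ (suc n)))
    r-decreasing : ∀ n → r (suc n) ≺ r n
    r-decreasing n = LeTop-just⁻¹ (proj₂ (rankAt-just γ (∈γ (suc (suc n))))) (proj₂ (rankAt-just γ (∈γ (suc n))))
      (rankAt-decreasing γ γ (s≤s z≤n) ≤-refl (∈γ (suc (suc n))) (λ _ → refl))
    descent : Descent _≺_ (λ x → ∃[ n ] r n ≡ x)
    descent (n , refl) = r (suc n) , r-decreasing n , suc n , refl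

  -- nothing is η, the rank of the trivial geodesic (infinite geodesics do not exist).
  rankOf : Maybe ℕ → Geodesic → Maybe C
  rankOf (just (suc n)) γ = rankAt (suc n) (displacement γ (suc n))
  rankOf _              _ = nothing

  rank : Geodesic → Maybe C
  rank γ = rankOf (dom γ) γ

  rank-monotone : ∀ γ κ → _⊏_ abelianGroup Generator γ κ → LeTop η (rank γ) (rank κ)
  rank-monotone γ κ ((dom⊇ , agree) , κ⋢γ) with dom γ in eγ | dom κ in eκ
  ... | nothing | _       = ⊥-elim (finite-domain γ eγ)
  ... | just m  | nothing = ⊥-elim (<-irrefl refl (dom⊇ (suc m) tt))
  ... | just m  | just k  with m ≟ k
  ...   | yes refl = ⊥-elim (κ⋢γ ((λ _ n∈ → n∈) , λ n n∈ t → ≡.sym (agree n n∈ t)))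
  ...   | no  m≢k with m | k | dom⊇ k ≤-refl
  ...     | zero   | zero   | _   = ⊥-elim (m≢k refl)
  ...     | suc m′ | zero   | _   with c , r≡c ← rankAt-just γ (last∈domain γ eγ) =
    subst (λ x → LeTop η x nothing) (≡.sym r≡c) fin<top
  ...     | suc m′ | suc k′ | k≤m =
    rankAt-decreasing γ κ (s≤s z≤n) (≤∧≢⇒< k≤m (λ k≡m → m≢k (≡.sym k≡m))) (last∈domain γ eγ)
      (++-cong {path γ 0} {path κ 0} {path γ (suc k′)} {path κ (suc k′)} (agree 0 z≤n) (agree (suc k′) ≤-refl))

  -- Chain geodesics

  ancestors : Node → List Node
  ancestors t@(⟨ _ ⟩)        = [ t ]
  ancestors t@(extend s _ _) = t ∷ ancestors s

  -- The ancestors of t (t included) of depth at most i.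
  chainPath : Node → ℕ → List Node
  chainPath t i with depth t ≤? i
  ... | yes _ = ancestors t
  chainPath ⟨ _ ⟩          i | no _ = []
  chainPath (extend s _ _) i | no _ = chainPath s i

  chainPath-saturated : ∀ {t i} → depth t ≤ i → chainPath t i ≡ ancestors t
  chainPath-saturated {t} {i} d≤i with depth t ≤? i
  ... | yes _  = refl
  ... | no d≰i = ⊥-elim (d≰i d≤i)

  chainPath-extend : ∀ {s x i} .{x≺ : x ≺ label s} → i ≤ depth s → chainPath (extend s x x≺) i ≡ chainPath s i
  chainPath-extend {s} {i = i} i≤d with suc (depth s) ≤? i
  ... | yes d<i = ⊥-elim (<-irrefl refl (≤-trans d<i i≤d))
  ... | no  _   = refl

  ancestors-shallow : ∀ t → All (λ u → depth u ≤ depth t) (ancestors t)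
  ancestors-shallow ⟨ _ ⟩          = ≤-refl ∷ []
  ancestors-shallow (extend s _ _) = ≤-refl ∷ All.map m≤n⇒m≤1+n (ancestors-shallow s)

  chainPath-shallow : ∀ t i → All (λ u → depth u ≤ depth t) (chainPath t i)
  chainPath-shallow t i with depth t ≤? i
  ... | yes _ = ancestors-shallow t
  chainPath-shallow ⟨ _ ⟩          i | no _ = []
  chainPath-shallow (extend s _ _) i | no _ = All.map m≤n⇒m≤1+n (chainPath-shallow s i)

  parity-shallow : ∀ {F d} t → All (λ u → depth u ≤ d) F → d < depth t → parity t F ≡ false
  parity-shallow {F} t F-shallow d<t with parity t F in t∈F
  ... | false = refl
  ... | true  = ⊥-elim (<-irrefl refl (≤-trans d<t (All.lookup F-shallow (parity⇒∈ t∈F))))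

  height-local : ∀ {F F′} t → (∀ u → depth u ≤ depth t → parity u F ≡ parity u F′) → height F t ≡ height F′ t
  height-local t@(⟨ _ ⟩)        F≈F′ = cong 𝟙 (F≈F′ t ≤-refl)
  height-local t@(extend s _ _) F≈F′ =
    cong₂ _+_ (cong 𝟙 (F≈F′ t ≤-refl)) (height-local s (λ u u≤s → F≈F′ u (m≤n⇒m≤1+n u≤s)))

  chainPath-step : ∀ t i → i < depth t → ∃[ u ] chainPath t (suc i) ≈ chainPath t i ++ [ u ]
  chainPath-step t@(⟨ _ ⟩) zero _ = t , λ _ → refl
  chainPath-step ⟨ _ ⟩ (suc _) (s≤s ())
  chainPath-step t@(extend s x x≺) i (s≤s i≤s) with m≤n⇒m<n∨m≡n i≤s
  ... | inj₁ i<s rewrite chainPath-extend {s} {x} {x≺ = x≺} i<s | chainPath-extend {s} {x} {x≺ = x≺} (<⇒≤ i<s) =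
    chainPath-step s i i<s
  ... | inj₂ refl rewrite chainPath-saturated {t} ≤-refl | chainPath-extend {s} {x} {x≺ = x≺} ≤-refl
                        | chainPath-saturated {s} ≤-refl =
    t , AbelianGroup.comm abelianGroup [ t ] (ancestors s)

  chainPath-spread : ∀ t m → m ≤ depth t → depth t ∸ m ≤ height (chainPath t m ++ ancestors t) t
  chainPath-spread t@(⟨ _ ⟩) zero    _         = subst (λ b → 1 ≤ 𝟙 b) (≡.sym parity-[ t ]) ≤-refl
  chainPath-spread ⟨ _ ⟩    (suc _) (s≤s z≤n) = z≤n
  chainPath-spread t@(extend s x x≺) m m≤t with m ≤? depth s
  ... | no  m≰s = ≤-trans (≤-reflexive (m≤n⇒m∸n≡0 (≰⇒> m≰s))) z≤n
  ... | yes m≤s rewrite chainPath-extend {s} {x} {x≺ = x≺} m≤s | +-∸-assoc 1 m≤s =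
    +-mono-≤ (≤-reflexive (cong 𝟙 (≡.sym t∈D)))
             (≤-trans (chainPath-spread s m m≤s) (≤-reflexive (height-local s D≈D′)))
    where
    A = chainPath s m
    B = ancestors s
    t∈D : parity t (A ++ t ∷ B) ≡ true
    t∈D rewrite parity-++ t A (t ∷ B) | parity-shallow t (chainPath-shallow s m) ≤-refl
              | dec-true (t ≟ₙ t) refl | parity-shallow t (ancestors-shallow s) ≤-refl = refl
    D≈D′ : ∀ u → depth u ≤ depth s → parity u (A ++ B) ≡ parity u (A ++ t ∷ B)
    D≈D′ u u≤s rewrite parity-++ u A (t ∷ B) | parity-++ u A B
      | dec-false (u ≟ₙ t) (λ u≡t → <-irrefl refl (subst (_≤ depth s) (cong depth u≡t) u≤s)) = refl

  chainPath-spread-between : ∀ t {m n} → m ≤ n → n ≤ depth t →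
                             ∃[ u ] n ∸ m ≤ height (chainPath t m ++ chainPath t n) u
  chainPath-spread-between t {m} {n} m≤n n≤t with m≤n⇒m<n∨m≡n n≤t
  ... | inj₂ refl rewrite chainPath-saturated {t} (≤-refl {n}) = t , chainPath-spread t m m≤n
  chainPath-spread-between t@(⟨ _ ⟩) z≤n _ | inj₁ (s≤s z≤n) = t , z≤n
  chainPath-spread-between (extend s x x≺) {m} {n} m≤n _ | inj₁ (s≤s n≤s)
    rewrite chainPath-extend {s} {x} {x≺ = x≺} n≤s | chainPath-extend {s} {x} {x≺ = x≺} (≤-trans m≤n n≤s) =
    chainPath-spread-between s m≤n n≤s

  chainGeodesic : Node → Geodesic
  chainGeodesic t = record
    { dom        = just (depth t)
    ; path       = chainPath t
    ; isPath     = chainPath-adjacent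
    ; isGeodesic = chainPath-geodesic
    }
    where
    chainPath-adjacent : ∀ i → suc i ≤ depth t → Adj abelianGroup Generator (chainPath t i) (chainPath t (suc i))
    chainPath-adjacent i i<t with u , step ← chainPath-step t i i<t =
      adj-∙ (λ {x} {y} → Generator-respects-≈ {x} {y}) proj₁ {chainPath t i} {chainPath t (suc i)} {[ u ]}
        [ u ]-generator step
    chainPath-geodesic : ∀ m n → m ≤ n → n ≤ depth t → ∀ k →
                         Walk abelianGroup Generator (chainPath t m) (chainPath t n) k → n ∸ m ≤ k
    chainPath-geodesic m n m≤n n≤t k w with u , spread ← chainPath-spread-between t m≤n n≤t =
      ≤-trans spread (height≤walkLength u w)

  trivialGeodesic : Geodesic
  trivialGeodesic = record
    { dom        = just 0
    ; path       = λ _ → []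
    ; isPath     = λ _ ()
    ; isGeodesic = λ m n _ n≤0 _ _ → ≤-trans (m∸n≤m n m) (≤-trans n≤0 z≤n)
    }

  _⊏ᵍ_ : Rel Geodesic ℓ
  _⊏ᵍ_ = _⊏_ abelianGroup Generator

  chainGeodesic-extend : ∀ t x .(x≺ : x ≺ label t) → chainGeodesic (extend t x x≺) ⊏ᵍ chainGeodesic t
  chainGeodesic-extend t x x≺ =
    ((λ _ n≤t → m≤n⇒m≤1+n n≤t) , (λ _ n≤t u → cong (parity u) (chainPath-extend {t} {x} {x≺ = x≺} n≤t))) ,
    λ (dom⊆ , _) → <-irrefl refl (dom⊆ (suc (depth t)) ≤-refl)

  chainGeodesic-⟨⟩ : ∀ a → chainGeodesic ⟨ a ⟩ ⊏ᵍ trivialGeodesic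
  chainGeodesic-⟨⟩ a =
    ((λ _ n≤0 → m≤n⇒m≤1+n n≤0) , λ { _ z≤n _ → refl }) , λ (dom⊆ , _) → <-irrefl refl (dom⊆ 1 ≤-refl)

  no-smaller-rank : ∀ a → ¬ HasRankInto abelianGroup Generator (OrdinalsUpToBelow η a)
  no-smaller-rank a (ζ , ζ-mono) = descent∧wf⇒empty descent wellFounded a (⟨ a ⟩ , refl , ρ⟨a⟩≺a)
    where
    ρ : Geodesic → C
    ρ γ = proj₁ (ζ γ)
    P : Pred C ℓ
    P x = ∃[ t ] label t ≡ x × ρ (chainGeodesic t) ≺ x
    descent : Descent _≺_ P
    descent (t , refl , ρ≺) = _ , ρ≺ , extend t _ ρ≺ , refl , ζ-mono _ _ (chainGeodesic-extend t _ ρ≺)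
    ρ⟨a⟩≺a : ρ (chainGeodesic ⟨ a ⟩) ≺ a
    ρ⟨a⟩≺a = ≺-≼-trans (ζ-mono _ _ (chainGeodesic-⟨⟩ a)) (proj₂ (ζ trivialGeodesic))

mainTheorem3 : ∀ {ℓ : Level} (η : WellOrder ℓ) →
    Σ (AbelianGroup ℓ ℓ) λ G →
    Σ (Pred (AbelianGroup.Carrier G) ℓ) λ S →
    RespectsEq G S × Generates G S × GenDiamEquals G S η
mainTheorem3 η =
  abelianGroup , Generator , (λ {x} {y} → Generator-respects-≈ {x} {y}) ,
  singletons-generate Generator [_]-generator ,
  (rank , rank-monotone) , no-smaller-rank
  where
  open ChainTree η
  open ParityGroup _≟ₙ_
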